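{- Let $p\ge1$ and let $k_1,\dots,k_p,r_1,\dots,r_p\ge0$ be integers with $k=k_1+\cdots+k_p$ and $r=r_1+\cdots+r_p$, and let $s\ge1$ and $n\ge sk$ be integers. Then \[ \binom{k}{k_1,\dots,k_p}S^{(s)}_r(n+r,k+r)=\sum_{\substack{l_1+\cdots+l_p=n\\ l_i\ge sk_i+(s-1)r_i}}\binom{n}{l_1,\dots,l_p}\prod_{i=1}^{p}S^{(s)}_{r_i}(l_i+r_i,k_i+r_i). \]
   Context: Fix an integer $s\ge1$. For integers $n,k,r\ge0$, $S^{(s)}_r(n,k)$ is the number of partitions of $\{1,\dots,n\}$ into exactly $k$ nonempty blocks such that $1,\dots,r$ lie in pairwise distinct blocks and every block has at least $s$ elements. Multinomial coefficients are the usual ones; the sum is over integers $l_1,\dots,l_p$. -}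

module Defs where

open import Data.Nat using (ℕ; zero; suc; _+_; _*_; _∸_; _≤_; _<_; _≤?_; _<?_)
open import Data.Nat.ListAction using (sum; product)
open import Data.Nat.Combinatorics using (_C_)
open import Data.Fin using (Fin; toℕ)
open import Data.Fin.Properties using (all?; any?; _≟_)
open import Data.Vec as Vec using (Vec; lookup)
open import Data.List as List using (List; length; filter; concatMap; allFin)
open import Data.Product using (Σ; _×_; ∃-syntax)
open import Relation.Nullary using (Dec; ¬_; _→-dec_; _×-dec_; ¬?)
open import Relation.Binary.PropositionalEquality using (_≡_)

-- A set partition of {1,…,n} (encoded as Fin n, element i+1 ↦ index i)
-- into exactly k blocks is represented canonically by the block-label map
-- v : Fin n → Fin k where blocks are numbered 0,1,…,k-1 in the order of
-- their smallest elements (restricted growth string).  This is a bijection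
-- between set partitions into exactly k blocks and the label maps that are
-- surjective and canonical.

allLabelings : (n k : ℕ) → List (Vec (Fin k) n)
allLabelings zero    k = List.[ Vec.[] ]
allLabelings (suc n) k =
  concatMap (λ c → List.map (c Vec.∷_) (allLabelings n k)) (allFin k)

-- every label occurs (exactly k nonempty blocks)
Surjective : ∀ {n k} → Vec (Fin k) n → Set
Surjective {n} {k} v = (c : Fin k) → ∃[ i ] lookup v i ≡ c

Canonical : ∀ {n k} → Vec (Fin k) n → Set
Canonical {n} {k} v =
  (i : Fin n) (c : Fin k) → toℕ c < toℕ (lookup v i) →
    ∃[ j ] (toℕ j < toℕ i × lookup v j ≡ c)

-- the elements 1,…,r (indices < r) lie in pairwise distinct blocks
FirstDistinct : ∀ {n k} → ℕ → Vec (Fin k) n → Set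
FirstDistinct {n} r v =
  (i j : Fin n) → toℕ i < r → toℕ j < r → ¬ (i ≡ j) → ¬ (lookup v i ≡ lookup v j)

blockSize : ∀ {n k} → Vec (Fin k) n → Fin k → ℕ
blockSize {n} v c = length (filter (λ i → lookup v i ≟ c) (allFin n))

BlocksAtLeast : ∀ {n k} → ℕ → Vec (Fin k) n → Set
BlocksAtLeast {n} {k} s v = (c : Fin k) → s ≤ blockSize v c

IsPartition : ∀ {n k} → (s r : ℕ) → Vec (Fin k) n → Set
IsPartition s r v = Surjective v × Canonical v × FirstDistinct r v × BlocksAtLeast s v

isPartition? : ∀ {n k} (s r : ℕ) (v : Vec (Fin k) n) → Dec (IsPartition s r v)
isPartition? {n} {k} s r v =
  all? (λ c → any? (λ i → lookup v i ≟ c))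
  ×-dec all? (λ i → all? (λ c → (toℕ c <? toℕ (lookup v i)) →-dec
                           any? (λ j → (toℕ j <? toℕ i) ×-dec (lookup v j ≟ c))))
  ×-dec all? (λ i → all? (λ j → (toℕ i <? r) →-dec ((toℕ j <? r) →-dec
                           (¬? (i ≟ j) →-dec ¬? (lookup v i ≟ lookup v j)))))
  ×-dec all? (λ c → s ≤? blockSize v c)

S : (s r n k : ℕ) → ℕ
S s r n k = length (filter (isPartition? s r) (allLabelings n k))

vsum : ∀ {p} → Vec ℕ p → ℕ
vsum = Vec.foldr _ _+_ 0

multinomial : ∀ {p} → Vec ℕ p → ℕ
multinomial Vec.[]       = 1
multinomial (l Vec.∷ ls) = ((l + vsum ls) C l) * multinomial ls

compositions : (p n : ℕ) → List (Vec ℕ p)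
compositions zero    zero    = List.[ Vec.[] ]
compositions zero    (suc n) = List.[]
compositions (suc p) n =
  concatMap (λ l → List.map (l Vec.∷_) (compositions p (n ∸ l)))
            (List.upTo (suc n))

lsum : List ℕ → ℕ
lsum = sum

prodFin : (p : ℕ) → (Fin p → ℕ) → ℕ
prodFin p f = product (List.map f (allFin p))

Admissible : ∀ {p} (s : ℕ) (ks rs ls : Vec ℕ p) → Set
Admissible {p} s ks rs ls =
  (i : Fin p) → s * lookup ks i + (s ∸ 1) * lookup rs i ≤ lookup ls i

admissible? : ∀ {p} (s : ℕ) (ks rs ls : Vec ℕ p) → Dec (Admissible s ks rs ls)
admissible? s ks rs ls = all? (λ i → s * lookup ks i + (s ∸ 1) * lookup rs i ≤? lookup ls i)

-- Write W(ds, n) for the number of words of length n over an alphabet with one letter per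
-- entry of ds, the letter i occurring at least ds[i] times. Labelling the k blocks that avoid
-- 1, …, r in all k! ways gives k! S^{(s)}_r(n + r, k + r) = W((s − 1)^r s^k, n): once 1, …, r
-- have opened their blocks, each of these still needs s − 1 of the n remaining elements and
-- each other block needs s. W is symmetric in ds and turns concatenation into binomial
-- convolution, so splitting (s − 1)^r s^k into the p groups (s − 1)^{r_i} s^{k_i} writes
-- k! S^{(s)}_r(n + r, k + r) as the multinomial convolution of the sequences
-- l ↦ k_i! S^{(s)}_{r_i}(l + r_i, k_i + r_i). Dividing by k_1! ⋯ k_p! gives the identity; the
-- compositions outside the summation range contribute zero.
module Submission where

open import Defs
open import Level using (0ℓ)
open import Function using (_∘_; id; _⇔_; mk⇔; Equivalence)
open import Data.Nat using (ℕ; zero; suc; _+_; _*_; _∸_; _≤_; _<_; _≤?_; _<?_; _!; NonZero; z≤n; s≤s; z<s; s<s; s≤s⁻¹)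
open import Data.Nat.Properties renaming (_≟_ to _≟ℕ_)
open import Data.Nat.Combinatorics using (_C_; nCk+nC[k+1]≡[n+1]C[k+1]; k>n⇒nCk≡0; nCk≡n!/k![n-k]!; k![n∸k]!∣n!)
open import Data.Nat.DivMod using (m/n*n≡m)
open import Data.Nat.Divisibility using (0∣⇒≡0)
open import Data.Nat.ListAction using (sum; product)
open import Data.Nat.ListAction.Properties using (sum-++; ∈⇒∣product; product≢0)
open import Data.Nat.Tactic.RingSolver using (solve-∀)
open import Data.Fin using (Fin; zero; suc; toℕ; fromℕ<)
open import Data.Fin.Properties using (toℕ-injective; toℕ-fromℕ<; toℕ<n; _≟_; all?; any?; ¬∀⟶∃¬)
import Data.Fin.Properties as Fin
open import Data.Vec using (Vec; []; _∷_; lookup)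
open import Data.List using (List; []; _∷_; _++_; [_]; _∷ʳ_; length; replicate; map; filter; concat; concatMap; applyUpTo; upTo; allFin; tabulate)
open import Data.List.Properties using (length-++; filter-++; filter-none; filter-accept; filter-reject; map-++; map-cong; map-∘; map-tabulate; ++-assoc; ++-identityʳ; length-replicate)
open import Data.List.Membership.Propositional using (_∈_)
open import Data.List.Membership.Propositional.Properties using (∈-map⁺; ∈-allFin)
open import Data.List.Relation.Unary.All as All using (All; []; _∷_; universal)
open import Data.List.Relation.Unary.All.Properties using (++⁻ʳ; map⁺)
open import Data.List.Relation.Binary.Permutation.Propositional as ↭ using (_↭_; ↭-refl; ↭-trans; ↭-prep; ↭-swap; ↭-reflexive)
open import Data.List.Relation.Binary.Permutation.Propositional.Properties using (++⁺ˡ; shifts)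
open import Data.Product using (_×_; _,_; ∃-syntax)
open import Data.Sum using (_⊎_; inj₁; inj₂; [_,_]′)
import Data.Sum as Sum
open import Relation.Nullary using (yes; no; ¬_; ¬?; contradiction; _×-dec_; _⊎-dec_; _→-dec_)
open import Relation.Unary using (Pred; Decidable)
open import Relation.Binary.Definitions using (tri<; tri≈; tri>)
open import Relation.Binary.PropositionalEquality using (_≡_; _≢_; refl; sym; trans; cong; cong₂; subst; subst₂; module ≡-Reasoning)
open ≡-Reasoning
open Equivalence using (to; from)

∑< : ℕ → (ℕ → ℕ) → ℕ
∑< zero    f = 0
∑< (suc m) f = f 0 + ∑< m (f ∘ suc)

syntax ∑< m (λ i → e) = ∑[ i < m ] e

∑-cong : ∀ m {f g : ℕ → ℕ} → (∀ i → i < m → f i ≡ g i) → ∑< m f ≡ ∑< m g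
∑-cong zero    f≡g = refl
∑-cong (suc m) f≡g = cong₂ _+_ (f≡g 0 z<s) (∑-cong m (λ i i<m → f≡g (suc i) (s<s i<m)))

∑-const : ∀ m c → ∑[ _ < m ] c ≡ m * c
∑-const zero    c = refl
∑-const (suc m) c = cong (c +_) (∑-const m c)

∑-zero : ∀ m {f : ℕ → ℕ} → (∀ i → i < m → f i ≡ 0) → ∑< m f ≡ 0
∑-zero m f≡0 = trans (∑-cong m f≡0) (trans (∑-const m 0) (*-zeroʳ m))

∑-single : ∀ {m} j (f : ℕ → ℕ) → j < m → (∀ i → i < m → i ≢ j → f i ≡ 0) → ∑< m f ≡ f j
∑-single zero    f (s≤s _) f≡0 =
  trans (cong (f 0 +_) (∑-zero _ (λ i i<m → f≡0 (suc i) (s<s i<m) λ ()))) (+-identityʳ (f 0))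
∑-single (suc j) f (s≤s j<m) f≡0 =
  cong₂ _+_ (f≡0 0 z<s λ ()) (∑-single j (f ∘ suc) j<m (λ i i<m i≢j → f≡0 (suc i) (s<s i<m) (i≢j ∘ suc-injective)))

∑-distrib-+ : ∀ m (f g : ℕ → ℕ) → ∑[ i < m ] (f i + g i) ≡ ∑< m f + ∑< m g
∑-distrib-+ zero    f g = refl
∑-distrib-+ (suc m) f g = begin
  (f 0 + g 0) + ∑[ i < m ] (f (suc i) + g (suc i))  ≡⟨ cong (f 0 + g 0 +_) (∑-distrib-+ m (f ∘ suc) (g ∘ suc)) ⟩
  (f 0 + g 0) + (∑< m (f ∘ suc) + ∑< m (g ∘ suc))   ≡⟨ +-+-comm (f 0) (g 0) _ _ ⟩
  (f 0 + ∑< m (f ∘ suc)) + (g 0 + ∑< m (g ∘ suc))   ∎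
  where
  +-+-comm : ∀ a b c d → (a + b) + (c + d) ≡ (a + c) + (b + d)
  +-+-comm = solve-∀

*-distribˡ-∑ : ∀ m c (f : ℕ → ℕ) → c * ∑< m f ≡ ∑[ i < m ] (c * f i)
*-distribˡ-∑ zero    c f = *-zeroʳ c
*-distribˡ-∑ (suc m) c f = trans (*-distribˡ-+ c (f 0) _) (cong (c * f 0 +_) (*-distribˡ-∑ m c (f ∘ suc)))

∑-init-last : ∀ m (f : ℕ → ℕ) → ∑< (suc m) f ≡ ∑< m f + f m
∑-init-last zero    f = +-comm (f 0) 0
∑-init-last (suc m) f = trans (cong (f 0 +_) (∑-init-last m (f ∘ suc))) (sym (+-assoc (f 0) _ _))

∑-split : ∀ a b (f : ℕ → ℕ) → ∑< (a + b) f ≡ ∑< a f + ∑[ i < b ] f (a + i)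
∑-split zero    b f = refl
∑-split (suc a) b f = trans (cong (f 0 +_) (∑-split a b (f ∘ suc))) (sym (+-assoc (f 0) _ _))

sum-concatMap : ∀ {A B : Set} (f : B → ℕ) (g : A → List B) xs →
  sum (map f (concatMap g xs)) ≡ sum (map (λ x → sum (map f (g x))) xs)
sum-concatMap f g []       = refl
sum-concatMap f g (x ∷ xs) =
  trans (cong sum (map-++ f (g x) _)) (trans (sum-++ (map f (g x)) _) (cong (sum (map f (g x)) +_) (sum-concatMap f g xs)))

sum-applyUpTo : ∀ m (f : ℕ → ℕ) (h : ℕ → ℕ) → sum (map h (applyUpTo f m)) ≡ ∑< m (h ∘ f)
sum-applyUpTo zero    f h = refl
sum-applyUpTo (suc m) f h = cong (h (f 0) +_) (sum-applyUpTo m (f ∘ suc) h)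

*-distribˡ-sum : ∀ {A : Set} c (f : A → ℕ) xs → c * sum (map f xs) ≡ sum (map (λ x → c * f x) xs)
*-distribˡ-sum c f []       = *-zeroʳ c
*-distribˡ-sum c f (x ∷ xs) = trans (*-distribˡ-+ c (f x) _) (cong (c * f x +_) (*-distribˡ-sum c f xs))

sum-filter : ∀ {A : Set} {P : Pred A 0ℓ} (P? : Decidable P) (f : A → ℕ) → (∀ x → ¬ P x → f x ≡ 0) →
  ∀ xs → sum (map f (filter P? xs)) ≡ sum (map f xs)
sum-filter P? f f≡0 []       = refl
sum-filter P? f f≡0 (x ∷ xs) with P? x
... | yes _  = cong (f x +_) (sum-filter P? f f≡0 xs)
... | no ¬px = trans (sum-filter P? f f≡0 xs) (cong (_+ sum (map f xs)) (sym (f≡0 x ¬px)))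

sum-replicate : ∀ n x → sum (replicate n x) ≡ n * x
sum-replicate zero    x = refl
sum-replicate (suc n) x = cong (x +_) (sum-replicate n x)

module _ {A : Set} {P Q : Pred A 0ℓ} (P? : Decidable P) (Q? : Decidable Q) where

  length-filter-cong : (∀ x → P x ⇔ Q x) → ∀ xs → length (filter P? xs) ≡ length (filter Q? xs)
  length-filter-cong P⇔Q []       = refl
  length-filter-cong P⇔Q (x ∷ xs) with P? x | Q? x
  ... | yes _  | yes _  = cong suc (length-filter-cong P⇔Q xs)
  ... | yes px | no ¬qx = contradiction (to (P⇔Q x) px) ¬qx
  ... | no ¬px | yes qx = contradiction (from (P⇔Q x) qx) ¬px
  ... | no _   | no _   = length-filter-cong P⇔Q xs

module _ {A : Set} {P : Pred A 0ℓ} (P? : Decidable P) where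

  length-filter-none : (∀ x → ¬ P x) → ∀ xs → length (filter P? xs) ≡ 0
  length-filter-none ¬P xs = cong length (filter-none P? (universal ¬P xs))

  length-filter-map : ∀ {B : Set} (f : B → A) xs → length (filter P? (map f xs)) ≡ length (filter (P? ∘ f) xs)
  length-filter-map f []       = refl
  length-filter-map f (x ∷ xs) with P? (f x)
  ... | yes _ = cong suc (length-filter-map f xs)
  ... | no _  = length-filter-map f xs

  length-filter-concatMap : ∀ {B : Set} (g : B → List A) xs →
    length (filter P? (concatMap g xs)) ≡ sum (map (λ x → length (filter P? (g x))) xs)
  length-filter-concatMap g []       = refl
  length-filter-concatMap g (x ∷ xs) = begin
    length (filter P? (g x ++ concatMap g xs))                   ≡⟨ cong length (filter-++ P? (g x) _) ⟩
    length (filter P? (g x) ++ filter P? (concatMap g xs))       ≡⟨ length-++ (filter P? (g x)) ⟩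
    length (filter P? (g x)) + length (filter P? (concatMap g xs)) ≡⟨ cong (length (filter P? (g x)) +_) (length-filter-concatMap g xs) ⟩
    length (filter P? (g x)) + sum (map (λ x → length (filter P? (g x))) xs) ∎

map-allFin-suc : ∀ {A : Set} n (f : Fin (suc n) → A) → map f (allFin (suc n)) ≡ f zero ∷ map (f ∘ suc) (allFin n)
map-allFin-suc n f = cong (f zero ∷_) (trans (map-tabulate suc f) (sym (map-tabulate id (f ∘ suc))))

sum-allFin : ∀ n (g : ℕ → ℕ) → sum (map (g ∘ toℕ) (allFin n)) ≡ ∑< n g
sum-allFin zero    g = refl
sum-allFin (suc n) g = trans (cong sum (map-allFin-suc n (g ∘ toℕ))) (cong (g 0 +_) (sum-allFin n (g ∘ suc)))

prodFin-suc : ∀ p (g : Fin (suc p) → ℕ) → prodFin (suc p) g ≡ g zero * prodFin p (g ∘ suc)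
prodFin-suc p g = cong product (map-allFin-suc p g)

prodFin-* : ∀ p (g h : Fin p → ℕ) → prodFin p g * prodFin p h ≡ prodFin p (λ i → g i * h i)
prodFin-* zero    g h = refl
prodFin-* (suc p) g h = begin
  prodFin (suc p) g * prodFin (suc p) h
    ≡⟨ cong₂ _*_ (prodFin-suc p g) (prodFin-suc p h) ⟩
  (g zero * prodFin p (g ∘ suc)) * (h zero * prodFin p (h ∘ suc))
    ≡⟨ interchange (g zero) _ (h zero) _ ⟩
  (g zero * h zero) * (prodFin p (g ∘ suc) * prodFin p (h ∘ suc))
    ≡⟨ cong ((g zero * h zero) *_) (prodFin-* p (g ∘ suc) (h ∘ suc)) ⟩
  (g zero * h zero) * prodFin p (λ i → g (suc i) * h (suc i))
    ≡⟨ prodFin-suc p (λ i → g i * h i) ⟨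
  prodFin (suc p) (λ i → g i * h i)
    ∎
  where
  interchange : ∀ a b c d → (a * b) * (c * d) ≡ (a * c) * (b * d)
  interchange = solve-∀

prodFin-zero : ∀ {p} (g : Fin p → ℕ) i → g i ≡ 0 → prodFin p g ≡ 0
prodFin-zero {p} g i gi≡0 = 0∣⇒≡0 (∈⇒∣product (subst (_∈ map g (allFin p)) gi≡0 (∈-map⁺ g (∈-allFin i))))

-- Binomial convolution

infixl 7 _⊛_

_⊛_ : (ℕ → ℕ) → (ℕ → ℕ) → ℕ → ℕ
(a ⊛ b) n = ∑[ l < suc n ] ((n C l) * (a l * b (n ∸ l)))

⊛-cong : ∀ {a a′ b b′ : ℕ → ℕ} → (∀ m → a m ≡ a′ m) → (∀ m → b m ≡ b′ m) →
         ∀ n → (a ⊛ b) n ≡ (a′ ⊛ b′) n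
⊛-cong {a} {a′} {b} {b′} a≡a′ b≡b′ n =
  ∑-cong (suc n) {λ l → (n C l) * (a l * b (n ∸ l))} {λ l → (n C l) * (a′ l * b′ (n ∸ l))}
         (λ l _ → cong ((n C l) *_) (cong₂ _*_ (a≡a′ l) (b≡b′ (n ∸ l))))

-- Pascal's rule makes the convolution satisfy the product rule for the shift a ↦ a ∘ suc.
⊛-leibniz : ∀ n (a b : ℕ → ℕ) → (a ⊛ b) (suc n) ≡ ((a ∘ suc) ⊛ b) n + (a ⊛ (b ∘ suc)) n
⊛-leibniz n a b = begin
  T₀ + ∑[ l < suc n ] ((suc n C suc l) * A l)
    ≡⟨ cong (T₀ +_) (∑-cong (suc n) (λ l _ → pascal l)) ⟩
  T₀ + ∑[ l < suc n ] ((n C l) * A l + (n C suc l) * A l)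
    ≡⟨ cong (T₀ +_) (∑-distrib-+ (suc n) (λ l → (n C l) * A l) (λ l → (n C suc l) * A l)) ⟩
  T₀ + (((a ∘ suc) ⊛ b) n + X)
    ≡⟨ +-left-comm T₀ (((a ∘ suc) ⊛ b) n) X ⟩
  ((a ∘ suc) ⊛ b) n + (T₀ + X)
    ≡⟨ cong (((a ∘ suc) ⊛ b) n +_) shifted ⟩
  ((a ∘ suc) ⊛ b) n + (a ⊛ (b ∘ suc)) n
    ∎
  where
  A : ℕ → ℕ
  A l = a (suc l) * b (n ∸ l)
  T₀ X : ℕ
  T₀ = (suc n C 0) * (a 0 * b (suc n))
  X  = ∑[ l < suc n ] ((n C suc l) * A l)
  pascal : ∀ l → (suc n C suc l) * A l ≡ (n C l) * A l + (n C suc l) * A l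
  pascal l = trans (cong (_* A l) (sym (nCk+nC[k+1]≡[n+1]C[k+1] n l))) (*-distribʳ-+ (A l) (n C l) _)
  +-left-comm : ∀ x y z → x + (y + z) ≡ y + (x + z)
  +-left-comm = solve-∀
  shifted : T₀ + X ≡ (a ⊛ (b ∘ suc)) n
  shifted = begin
    T₀ + X
      ≡⟨ cong (T₀ +_) (∑-init-last n _) ⟩
    T₀ + (∑[ l < n ] ((n C suc l) * A l) + (n C suc n) * A n)
      ≡⟨ cong (λ c → T₀ + (∑[ l < n ] ((n C suc l) * A l) + c * A n)) (k>n⇒nCk≡0 (n<1+n n)) ⟩
    T₀ + (∑[ l < n ] ((n C suc l) * A l) + 0)
      ≡⟨ cong (T₀ +_) (+-identityʳ _) ⟩
    T₀ + ∑[ l < n ] ((n C suc l) * A l)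
      ≡⟨ cong (T₀ +_) (∑-cong n (λ l l<n → cong (λ m → (n C suc l) * (a (suc l) * b m)) (+-∸-assoc 1 l<n))) ⟩
    (a ⊛ (b ∘ suc)) n
      ∎

⊛-comm : ∀ n (a b : ℕ → ℕ) → (a ⊛ b) n ≡ (b ⊛ a) n
⊛-comm zero    a b = cong (λ x → 1 * x + 0) (*-comm (a 0) (b 0))
⊛-comm (suc n) a b = begin
  (a ⊛ b) (suc n)                                   ≡⟨ ⊛-leibniz n a b ⟩
  ((a ∘ suc) ⊛ b) n + (a ⊛ (b ∘ suc)) n             ≡⟨ cong₂ _+_ (⊛-comm n (a ∘ suc) b) (⊛-comm n a (b ∘ suc)) ⟩
  (b ⊛ (a ∘ suc)) n + ((b ∘ suc) ⊛ a) n             ≡⟨ +-comm ((b ⊛ (a ∘ suc)) n) (((b ∘ suc) ⊛ a) n) ⟩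
  ((b ∘ suc) ⊛ a) n + (b ⊛ (a ∘ suc)) n             ≡⟨ sym (⊛-leibniz n b a) ⟩
  (b ⊛ a) (suc n)                                   ∎

⊛-zeroˡ : ∀ n (b : ℕ → ℕ) → ((λ _ → 0) ⊛ b) n ≡ 0
⊛-zeroˡ n b = ∑-zero (suc n) (λ l _ → *-zeroʳ (n C l))

⊛-distribʳ-+ : ∀ n (a a′ b : ℕ → ℕ) → ((λ m → a m + a′ m) ⊛ b) n ≡ (a ⊛ b) n + (a′ ⊛ b) n
⊛-distribʳ-+ n a a′ b =
  trans (∑-cong (suc n) {g = λ l → (n C l) * (a l * b (n ∸ l)) + (n C l) * (a′ l * b (n ∸ l))}
                  (λ l _ → distrib (n C l) (a l) (a′ l) (b (n ∸ l))))
          (∑-distrib-+ (suc n) (λ l → (n C l) * (a l * b (n ∸ l))) (λ l → (n C l) * (a′ l * b (n ∸ l))))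
  where
  distrib : ∀ c x y z → c * ((x + y) * z) ≡ c * (x * z) + c * (y * z)
  distrib = solve-∀

∑-⊛ˡ : ∀ j n (f : ℕ → ℕ → ℕ) (b : ℕ → ℕ) → ∑[ i < j ] (f i ⊛ b) n ≡ ((λ m → ∑[ i < j ] f i m) ⊛ b) n
∑-⊛ˡ zero    n f b = sym (⊛-zeroˡ n b)
∑-⊛ˡ (suc j) n f b = begin
  (f 0 ⊛ b) n + ∑[ i < j ] (f (suc i) ⊛ b) n             ≡⟨ cong ((f 0 ⊛ b) n +_) (∑-⊛ˡ j n (f ∘ suc) b) ⟩
  (f 0 ⊛ b) n + ((λ m → ∑[ i < j ] f (suc i) m) ⊛ b) n   ≡⟨ sym (⊛-distribʳ-+ n (f 0) (λ m → ∑[ i < j ] f (suc i) m) b) ⟩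
  ((λ m → ∑[ i < suc j ] f i m) ⊛ b) n                   ∎

∑-⊛ʳ : ∀ j n (a : ℕ → ℕ) (f : ℕ → ℕ → ℕ) → ∑[ i < j ] (a ⊛ f i) n ≡ (a ⊛ (λ m → ∑[ i < j ] f i m)) n
∑-⊛ʳ j n a f = begin
  ∑[ i < j ] (a ⊛ f i) n                    ≡⟨ ∑-cong j (λ i _ → ⊛-comm n a (f i)) ⟩
  ∑[ i < j ] (f i ⊛ a) n                    ≡⟨ ∑-⊛ˡ j n f a ⟩
  ((λ m → ∑[ i < j ] f i m) ⊛ a) n          ≡⟨ ⊛-comm n (λ m → ∑[ i < j ] f i m) a ⟩
  (a ⊛ (λ m → ∑[ i < j ] f i m)) n          ∎

δ₀ : ℕ → ℕ
δ₀ zero    = 1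
δ₀ (suc _) = 0

⊛ⁿ : ∀ p → (Fin p → ℕ → ℕ) → ℕ → ℕ
⊛ⁿ zero    f = δ₀
⊛ⁿ (suc p) f = f zero ⊛ ⊛ⁿ p (f ∘ suc)

⊛ⁿ-cong : ∀ p {f g : Fin p → ℕ → ℕ} → (∀ i m → f i m ≡ g i m) → ∀ m → ⊛ⁿ p f m ≡ ⊛ⁿ p g m
⊛ⁿ-cong zero    f≡g m = refl
⊛ⁿ-cong (suc p) f≡g m = ⊛-cong (f≡g zero) (⊛ⁿ-cong p (f≡g ∘ suc)) m

-- Words with lower bounds on the letter multiplicities

allZero : List ℕ → ℕ
allZero []          = 1
allZero (zero ∷ ds) = allZero ds
allZero (suc _ ∷ _) = 0

decAt : ℕ → List ℕ → List ℕ
decAt _       []       = []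
decAt zero    (d ∷ ds) = d ∸ 1 ∷ ds
decAt (suc i) (d ∷ ds) = d ∷ decAt i ds

-- The number of words of length n over the alphabet {0, …, length ds − 1} in which
-- every letter i occurs at least ds[i] times, counted by the first letter.
wordsAtLeast : List ℕ → ℕ → ℕ
wordsAtLeast ds zero    = allZero ds
wordsAtLeast ds (suc n) = ∑[ i < length ds ] wordsAtLeast (decAt i ds) n

allZero-++ : ∀ xs ys → allZero (xs ++ ys) ≡ allZero xs * allZero ys
allZero-++ []           ys = sym (+-identityʳ _)
allZero-++ (zero ∷ xs)  ys = allZero-++ xs ys
allZero-++ (suc _ ∷ xs) ys = refl

allZero-yes : ∀ {ds} → All (_≡ 0) ds → allZero ds ≡ 1
allZero-yes []          = refl
allZero-yes (refl ∷ zs) = allZero-yes zs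

allZero-no : ∀ {ds} → ¬ All (_≡ 0) ds → allZero ds ≡ 0
allZero-no {[]}         ¬zs = contradiction [] ¬zs
allZero-no {zero ∷ ds}  ¬zs = allZero-no (¬zs ∘ (refl ∷_))
allZero-no {suc _ ∷ ds} ¬zs = refl

length-decAt : ∀ i ds → length (decAt i ds) ≡ length ds
length-decAt i       []       = refl
length-decAt zero    (d ∷ ds) = refl
length-decAt (suc i) (d ∷ ds) = cong suc (length-decAt i ds)

decAt-++ˡ : ∀ {i} xs ys → i < length xs → decAt i (xs ++ ys) ≡ decAt i xs ++ ys
decAt-++ˡ {zero}  (x ∷ xs) ys _           = refl
decAt-++ˡ {suc i} (x ∷ xs) ys (s≤s i<xs) = cong (x ∷_) (decAt-++ˡ xs ys i<xs)

decAt-++ʳ : ∀ i xs ys → decAt (length xs + i) (xs ++ ys) ≡ xs ++ decAt i ys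
decAt-++ʳ i []       ys = refl
decAt-++ʳ i (x ∷ xs) ys = cong (x ∷_) (decAt-++ʳ i xs ys)

wordsAtLeast-++-suc : ∀ xs ys n →
  wordsAtLeast (xs ++ ys) (suc n) ≡
  ∑[ i < length xs ] wordsAtLeast (decAt i xs ++ ys) n + ∑[ i < length ys ] wordsAtLeast (xs ++ decAt i ys) n
wordsAtLeast-++-suc xs ys n = begin
  ∑[ i < length (xs ++ ys) ] W (decAt i (xs ++ ys))
    ≡⟨ cong (λ m → ∑[ i < m ] W (decAt i (xs ++ ys))) (length-++ xs) ⟩
  ∑[ i < length xs + length ys ] W (decAt i (xs ++ ys))
    ≡⟨ ∑-split (length xs) (length ys) _ ⟩
  ∑[ i < length xs ] W (decAt i (xs ++ ys)) + ∑[ i < length ys ] W (decAt (length xs + i) (xs ++ ys))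
    ≡⟨ cong₂ _+_ (∑-cong (length xs) (λ i i<xs → cong W (decAt-++ˡ xs ys i<xs)))
                 (∑-cong (length ys) (λ i _ → cong W (decAt-++ʳ i xs ys))) ⟩
  ∑[ i < length xs ] W (decAt i xs ++ ys) + ∑[ i < length ys ] W (xs ++ decAt i ys)
    ∎
  where
  W : List ℕ → ℕ
  W ds = wordsAtLeast ds n

-- Choosing the positions that carry the letters of xs splits a word over xs ++ ys.
wordsAtLeast-++ : ∀ xs ys n → wordsAtLeast (xs ++ ys) n ≡ (wordsAtLeast xs ⊛ wordsAtLeast ys) n
wordsAtLeast-++ xs ys zero    = trans (allZero-++ xs ys) (sym (trans (+-identityʳ _) (*-identityˡ _)))
wordsAtLeast-++ xs ys (suc n) = begin
  wordsAtLeast (xs ++ ys) (suc n)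
    ≡⟨ wordsAtLeast-++-suc xs ys n ⟩
  ∑[ i < length xs ] wordsAtLeast (decAt i xs ++ ys) n + ∑[ i < length ys ] wordsAtLeast (xs ++ decAt i ys) n
    ≡⟨ cong₂ _+_ (∑-cong (length xs) (λ i _ → wordsAtLeast-++ (decAt i xs) ys n))
                 (∑-cong (length ys) (λ i _ → wordsAtLeast-++ xs (decAt i ys) n)) ⟩
  ∑[ i < length xs ] (W (decAt i xs) ⊛ W ys) n + ∑[ i < length ys ] (W xs ⊛ W (decAt i ys)) n
    ≡⟨ cong₂ _+_ (∑-⊛ˡ (length xs) n (λ i → W (decAt i xs)) (W ys))
                 (∑-⊛ʳ (length ys) n (W xs) (λ i → W (decAt i ys))) ⟩
  ((W xs ∘ suc) ⊛ W ys) n + (W xs ⊛ (W ys ∘ suc)) n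
    ≡⟨ sym (⊛-leibniz n (W xs) (W ys)) ⟩
  (W xs ⊛ W ys) (suc n)
    ∎
  where
  W : List ℕ → ℕ → ℕ
  W = wordsAtLeast

wordsAtLeast-↭ : ∀ {xs ys} → xs ↭ ys → ∀ n → wordsAtLeast xs n ≡ wordsAtLeast ys n
wordsAtLeast-↭ ↭.refl n = refl
wordsAtLeast-↭ (↭.prep x xs↭ys) n = begin
  wordsAtLeast ([ x ] ++ _) n                          ≡⟨ wordsAtLeast-++ [ x ] _ n ⟩
  (wordsAtLeast [ x ] ⊛ wordsAtLeast _) n              ≡⟨ ⊛-cong {a = wordsAtLeast [ x ]} (λ _ → refl) (wordsAtLeast-↭ xs↭ys) n ⟩
  (wordsAtLeast [ x ] ⊛ wordsAtLeast _) n              ≡⟨ wordsAtLeast-++ [ x ] _ n ⟨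
  wordsAtLeast ([ x ] ++ _) n                          ∎
wordsAtLeast-↭ (↭.swap x y xs↭ys) n = begin
  wordsAtLeast ((x ∷ y ∷ []) ++ _) n                   ≡⟨ wordsAtLeast-++ (x ∷ y ∷ []) _ n ⟩
  (wordsAtLeast (x ∷ y ∷ []) ⊛ wordsAtLeast _) n       ≡⟨ ⊛-cong xy≡yx (wordsAtLeast-↭ xs↭ys) n ⟩
  (wordsAtLeast (y ∷ x ∷ []) ⊛ wordsAtLeast _) n       ≡⟨ wordsAtLeast-++ (y ∷ x ∷ []) _ n ⟨
  wordsAtLeast ((y ∷ x ∷ []) ++ _) n                   ∎
  where
  xy≡yx : ∀ m → wordsAtLeast (x ∷ y ∷ []) m ≡ wordsAtLeast (y ∷ x ∷ []) m
  xy≡yx m = trans (wordsAtLeast-++ [ x ] [ y ] m)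
                  (trans (⊛-comm m (wordsAtLeast [ x ]) (wordsAtLeast [ y ])) (sym (wordsAtLeast-++ [ y ] [ x ] m)))
wordsAtLeast-↭ (↭.trans xs↭ys ys↭zs) n = trans (wordsAtLeast-↭ xs↭ys n) (wordsAtLeast-↭ ys↭zs n)

sum-decAt : ∀ i ds → sum ds ≤ suc (sum (decAt i ds))
sum-decAt i       []           = z≤n
sum-decAt zero    (zero ∷ ds)  = n≤1+n (sum ds)
sum-decAt zero    (suc d ∷ ds) = ≤-refl
sum-decAt (suc i) (d ∷ ds)     = ≤-trans (+-monoʳ-≤ d (sum-decAt i ds)) (≤-reflexive (+-suc d _))

wordsAtLeast-< : ∀ ds n → n < sum ds → wordsAtLeast ds n ≡ 0
wordsAtLeast-< (zero ∷ ds)  zero    0<ds = wordsAtLeast-< ds zero 0<ds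
wordsAtLeast-< (suc _ ∷ ds) zero    _    = refl
wordsAtLeast-< ds           (suc n) n<ds =
  ∑-zero (length ds) (λ i _ → wordsAtLeast-< (decAt i ds) n (s≤s⁻¹ (≤-trans n<ds (sum-decAt i ds))))

decAt-replicate-↭ : ∀ {i} m x → i < suc m → decAt i (replicate (suc m) x) ↭ x ∸ 1 ∷ replicate m x
decAt-replicate-↭ {zero}  m       x _            = ↭-refl
decAt-replicate-↭ {suc i} (suc m) x (s≤s i<1+m) = ↭-trans (↭-prep x (decAt-replicate-↭ m x i<1+m)) (↭-swap x (x ∸ 1) ↭-refl)

wordsAtLeast-decAt-replicate : ∀ ds m x n →
  ∑[ i < suc m ] wordsAtLeast (ds ++ decAt i (replicate (suc m) x)) n ≡ suc m * wordsAtLeast (ds ++ x ∸ 1 ∷ replicate m x) n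
wordsAtLeast-decAt-replicate ds m x n = begin
  ∑[ i < suc m ] wordsAtLeast (ds ++ decAt i (replicate (suc m) x)) n
    ≡⟨ ∑-cong (suc m) (λ i i<1+m → wordsAtLeast-↭ (++⁺ˡ ds (decAt-replicate-↭ m x i<1+m)) n) ⟩
  ∑[ _ < suc m ] wordsAtLeast (ds ++ x ∸ 1 ∷ replicate m x) n
    ≡⟨ ∑-const (suc m) _ ⟩
  suc m * wordsAtLeast (ds ++ x ∸ 1 ∷ replicate m x) n
    ∎

wordsAtLeast-concat : ∀ p (D : Fin p → List ℕ) m → wordsAtLeast (concat (map D (allFin p))) m ≡ ⊛ⁿ p (wordsAtLeast ∘ D) m
wordsAtLeast-concat zero    D zero    = refl
wordsAtLeast-concat zero    D (suc m) = refl
wordsAtLeast-concat (suc p) D m       = begin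
  wordsAtLeast (concat (map D (allFin (suc p)))) m
    ≡⟨ cong (λ xss → wordsAtLeast (concat xss) m) (map-allFin-suc p D) ⟩
  wordsAtLeast (D zero ++ concat (map (D ∘ suc) (allFin p))) m
    ≡⟨ wordsAtLeast-++ (D zero) _ m ⟩
  (wordsAtLeast (D zero) ⊛ wordsAtLeast (concat (map (D ∘ suc) (allFin p)))) m
    ≡⟨ ⊛-cong {a = wordsAtLeast (D zero)} (λ _ → refl) (wordsAtLeast-concat p (D ∘ suc)) m ⟩
  (wordsAtLeast (D zero) ⊛ ⊛ⁿ p (wordsAtLeast ∘ D ∘ suc)) m
    ∎

blockDemands : ℕ → ℕ → ℕ → List ℕ
blockDemands s r k = replicate r (s ∸ 1) ++ replicate k s

replicate-+ : ∀ {A : Set} m n (x : A) → replicate (m + n) x ≡ replicate m x ++ replicate n x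
replicate-+ zero    n x = refl
replicate-+ (suc m) n x = cong (x ∷_) (replicate-+ m n x)

++-interchange-↭ : ∀ {A : Set} (a b c d : List A) → (a ++ b) ++ (c ++ d) ↭ (a ++ c) ++ (b ++ d)
++-interchange-↭ a b c d =
  ↭-trans (↭-reflexive (++-assoc a b (c ++ d)))
          (↭-trans (++⁺ˡ a (shifts b c)) (↭-reflexive (sym (++-assoc a c (b ++ d)))))

concat-blockDemands-↭ : ∀ s {p} (ks rs : Vec ℕ p) →
  concat (map (λ i → blockDemands s (lookup rs i) (lookup ks i)) (allFin p)) ↭ blockDemands s (vsum rs) (vsum ks)
concat-blockDemands-↭ s []       []       = ↭-refl
concat-blockDemands-↭ s {suc p} (k ∷ ks) (r ∷ rs) =
  ↭-trans (↭-reflexive (cong concat (map-allFin-suc p (λ i → blockDemands s (lookup (r ∷ rs) i) (lookup (k ∷ ks) i)))))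
    (↭-trans (++⁺ˡ (blockDemands s r k) (concat-blockDemands-↭ s ks rs))
      (↭-trans (++-interchange-↭ (replicate r (s ∸ 1)) (replicate k s) (replicate (vsum rs) (s ∸ 1)) (replicate (vsum ks) s))
        (↭-reflexive (sym (cong₂ _++_ (replicate-+ r (vsum rs) (s ∸ 1)) (replicate-+ k (vsum ks) s))))))

-- Counting partitions through their canonical label maps

length-∷ʳ : ∀ {A : Set} (xs : List A) x → length (xs ∷ʳ x) ≡ suc (length xs)
length-∷ʳ xs x = trans (length-++ xs) (+-comm (length xs) 1)

module _ {n K} (c : Fin K) (w : Vec (Fin K) n) where

  private
    blockSize-tail : ∀ d → length (filter (λ i → lookup (c ∷ w) i ≟ d) (tabulate suc)) ≡ blockSize w d
    blockSize-tail d = trans (cong (length ∘ filter (λ i → lookup (c ∷ w) i ≟ d)) (sym (map-tabulate id suc)))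
                             (length-filter-map (λ i → lookup (c ∷ w) i ≟ d) suc (allFin n))

  blockSize-∷-≡ : blockSize (c ∷ w) c ≡ suc (blockSize w c)
  blockSize-∷-≡ with c ≟ c
  ... | yes _   = cong suc (blockSize-tail c)
  ... | no c≢c = contradiction refl c≢c

  blockSize-∷-≢ : ∀ {d} → c ≢ d → blockSize (c ∷ w) d ≡ blockSize w d
  blockSize-∷-≢ {d} c≢d with c ≟ d
  ... | yes c≡d = contradiction c≡d c≢d
  ... | no _    = blockSize-tail d

module LabelCounting (s K : ℕ) where

  demand : List ℕ → ℕ → ℕ
  demand []       _       = s
  demand (d ∷ ds) zero    = d
  demand (d ∷ ds) (suc i) = demand ds i

  demand-decAt-≡ : ∀ {i} ds → i < length ds → demand (decAt i ds) i ≡ demand ds i ∸ 1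
  demand-decAt-≡ {zero}  (d ∷ ds) _          = refl
  demand-decAt-≡ {suc i} (d ∷ ds) (s≤s i<ds) = demand-decAt-≡ ds i<ds

  demand-decAt-≢ : ∀ {i i′} ds → i ≢ i′ → demand (decAt i ds) i′ ≡ demand ds i′
  demand-decAt-≢ {_}     {_}     []       _     = refl
  demand-decAt-≢ {zero}  {zero}  (d ∷ ds) 0≢0   = contradiction refl 0≢0
  demand-decAt-≢ {zero}  {suc _} (d ∷ ds) _     = refl
  demand-decAt-≢ {suc _} {zero}  (d ∷ ds) _     = refl
  demand-decAt-≢ {suc i} {suc _} (d ∷ ds) i≢i′ = demand-decAt-≢ ds (i≢i′ ∘ cong suc)

  demand-∷ʳ-≡ : ∀ ds → demand (ds ∷ʳ (s ∸ 1)) (length ds) ≡ demand ds (length ds) ∸ 1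
  demand-∷ʳ-≡ []       = refl
  demand-∷ʳ-≡ (d ∷ ds) = demand-∷ʳ-≡ ds

  demand-∷ʳ-≢ : ∀ {i} ds x → i ≢ length ds → demand (ds ∷ʳ x) i ≡ demand ds i
  demand-∷ʳ-≢ {zero}  []       x 0≢0 = contradiction refl 0≢0
  demand-∷ʳ-≢ {suc i} []       x _   = refl
  demand-∷ʳ-≢ {zero}  (d ∷ ds) x _   = refl
  demand-∷ʳ-≢ {suc i} (d ∷ ds) x i≢ = demand-∷ʳ-≢ ds x (i≢ ∘ cong suc)

  All-zero⇒demand : ∀ {ds i} → All (_≡ 0) ds → i < length ds → demand ds i ≡ 0
  All-zero⇒demand {i = zero}  (d≡0 ∷ _)  _          = d≡0
  All-zero⇒demand {i = suc i} (_ ∷ zs)   (s≤s i<ds) = All-zero⇒demand zs i<ds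

  demand⇒All-zero : ∀ ds → (∀ i → i < length ds → demand ds i ≡ 0) → All (_≡ 0) ds
  demand⇒All-zero []       _   = []
  demand⇒All-zero (d ∷ ds) ds≡0 = ds≡0 0 z<s ∷ demand⇒All-zero ds (λ i i<ds → ds≡0 (suc i) (s<s i<ds))

  CoveredFrom : ∀ {n} → ℕ → Vec (Fin K) n → Set
  CoveredFrom j w = ∀ c → toℕ c < j ⊎ ∃[ i ] lookup w i ≡ c

  CanonicalFrom : ∀ {n} → ℕ → Vec (Fin K) n → Set
  CanonicalFrom {n} j w = ∀ (i : Fin n) c → toℕ c < toℕ (lookup w i) →
    toℕ c < j ⊎ ∃[ i′ ] (toℕ i′ < toℕ i × lookup w i′ ≡ c)

  OpeningFrom : ∀ {n} → ℕ → ℕ → Vec (Fin K) n → Set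
  OpeningFrom {n} j r w = (∀ (i : Fin n) → toℕ i < r → j ≤ toℕ (lookup w i)) × FirstDistinct r w

  MeetsDemands : ∀ {n} → List ℕ → Vec (Fin K) n → Set
  MeetsDemands ds w = ∀ c → demand ds (toℕ c) ≤ blockSize w c

  ValidAt : ∀ {n} → ℕ → List ℕ → ℕ → Vec (Fin K) n → Set
  ValidAt j ds r w = CoveredFrom j w × CanonicalFrom j w × OpeningFrom j r w × MeetsDemands ds w

  -- Valid ds r w: w labels the elements left after a prefix that has opened the blocks
  -- 0, …, length ds − 1, where block c still needs ds[c] more elements (an unopened block
  -- needs s), and the first r elements of w must open new blocks.
  Valid : ∀ {n} → List ℕ → ℕ → Vec (Fin K) n → Set
  Valid ds = ValidAt (length ds) ds

  validAt? : ∀ {n} j ds r → Decidable (ValidAt {n} j ds r)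
  validAt? j ds r w =
    all? (λ c → (toℕ c <? j) ⊎-dec any? (λ i → lookup w i ≟ c))
    ×-dec all? (λ i → all? (λ c → (toℕ c <? toℕ (lookup w i)) →-dec
                 ((toℕ c <? j) ⊎-dec any? (λ i′ → (toℕ i′ <? toℕ i) ×-dec (lookup w i′ ≟ c)))))
    ×-dec (all? (λ i → (toℕ i <? r) →-dec (j ≤? toℕ (lookup w i)))
           ×-dec all? (λ i → all? (λ i′ → (toℕ i <? r) →-dec ((toℕ i′ <? r) →-dec
                          (¬? (i ≟ i′) →-dec ¬? (lookup w i ≟ lookup w i′))))))
    ×-dec all? (λ c → demand ds (toℕ c) ≤? blockSize w c)

  valid? : ∀ {n} ds r → Decidable (Valid {n} ds r)
  valid? ds = validAt? (length ds) ds

  count : ∀ {n} {P : Pred (Vec (Fin K) n) 0ℓ} → Decidable P → ℕ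
  count {n} P? = length (filter P? (allLabelings n K))

  count-suc : ∀ {n} {P : Pred (Vec (Fin K) (suc n)) 0ℓ} (P? : Decidable P) →
    count P? ≡ sum (map (λ c → count (λ w → P? (c ∷ w))) (allFin K))
  count-suc {n} P? = trans (length-filter-concatMap P? _ (allFin K))
    (cong sum (map-cong (λ c → length-filter-map P? (c ∷_) (allLabelings n K)) (allFin K)))

  opening-zero : ∀ {n j} (v : Vec (Fin K) n) → OpeningFrom j 0 v
  opening-zero _ = (λ _ ()) , (λ _ _ ())

  module _ {n} {c : Fin K} {w : Vec (Fin K) n} where

    covered-∷-old : ∀ {j} → toℕ c < j → CoveredFrom j (c ∷ w) → CoveredFrom j w
    covered-∷-old c<j cov d with cov d
    ... | inj₁ d<j            = inj₁ d<j
    ... | inj₂ (zero , refl)  = inj₁ c<j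
    ... | inj₂ (suc i , wi≡d) = inj₂ (i , wi≡d)

    covered-∷ : ∀ {j} → CoveredFrom j w → CoveredFrom j (c ∷ w)
    covered-∷ cov d = Sum.map₂ (λ (i , wi≡d) → suc i , wi≡d) (cov d)

    covered-∷-new : ∀ {j} → toℕ c ≡ j → CoveredFrom j (c ∷ w) ⇔ CoveredFrom (suc j) w
    covered-∷-new {j} c≡j = mk⇔ to′ from′
      where
      to′ : CoveredFrom j (c ∷ w) → CoveredFrom (suc j) w
      to′ cov d with cov d
      ... | inj₁ d<j            = inj₁ (m<n⇒m<1+n d<j)
      ... | inj₂ (zero , refl)  = inj₁ (s≤s (≤-reflexive c≡j))
      ... | inj₂ (suc i , wi≡d) = inj₂ (i , wi≡d)
      from′ : CoveredFrom (suc j) w → CoveredFrom j (c ∷ w)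
      from′ cov d with cov d
      ... | inj₂ (i , wi≡d) = inj₂ (suc i , wi≡d)
      ... | inj₁ d<1+j with m<1+n⇒m<n∨m≡n d<1+j
      ...   | inj₁ d<j = inj₁ d<j
      ...   | inj₂ d≡j = inj₂ (zero , toℕ-injective (trans c≡j (sym d≡j)))

    -- A label above j would need the unused label j to occur before position 0.
    canonical-head : ∀ {j} → CanonicalFrom j (c ∷ w) → toℕ c ≤ j
    canonical-head {j} can with toℕ c ≤? j
    ... | yes c≤j = c≤j
    ... | no c≰j  = contradiction (can zero (fromℕ< j<K) j′<c) [ <-irrefl (toℕ-fromℕ< j<K) , (λ { (_ , () , _) }) ]′
      where
      j<c : j < toℕ c
      j<c = ≰⇒> c≰j
      j<K : j < K
      j<K = <-trans j<c (toℕ<n c)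
      j′<c : toℕ (fromℕ< j<K) < toℕ c
      j′<c = subst (_< toℕ c) (sym (toℕ-fromℕ< j<K)) j<c

    canonical-tail : ∀ {j j′} → toℕ c < j′ → j ≤ j′ → CanonicalFrom j (c ∷ w) → CanonicalFrom j′ w
    canonical-tail c<j′ j≤j′ can i d d<wi with can (suc i) d d<wi
    ... | inj₁ d<j                          = inj₁ (<-≤-trans d<j j≤j′)
    ... | inj₂ (zero , _ , refl)            = inj₁ c<j′
    ... | inj₂ (suc i′ , s≤s i′<i , wi′≡d) = inj₂ (i′ , i′<i , wi′≡d)

    canonical-∷ : ∀ {j j′} → toℕ c ≤ j → (∀ d → toℕ d < j′ → toℕ d < j ⊎ d ≡ c) →
                  CanonicalFrom j′ w → CanonicalFrom j (c ∷ w)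
    canonical-∷ c≤j _     can zero    d d<c = inj₁ (<-≤-trans d<c c≤j)
    canonical-∷ c≤j new⇒c can (suc i) d d<wi with can i d d<wi
    ... | inj₂ (i′ , i′<i , wi′≡d) = inj₂ (suc i′ , s<s i′<i , wi′≡d)
    ... | inj₁ d<j′ with new⇒c d d<j′
    ...   | inj₁ d<j  = inj₁ d<j
    ...   | inj₂ refl = inj₂ (zero , z<s , refl)

    ¬opening-∷-old : ∀ {j r} → toℕ c < j → ¬ OpeningFrom j (suc r) (c ∷ w)
    ¬opening-∷-old c<j (≥j , _) = <⇒≱ c<j (≥j zero z<s)

    opening-∷-new : ∀ {j r} → toℕ c ≡ j → OpeningFrom j r (c ∷ w) ⇔ OpeningFrom (suc j) (r ∸ 1) w
    opening-∷-new {j} {zero}  c≡j = mk⇔ (λ _ → opening-zero w) (λ _ → opening-zero (c ∷ w))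
    opening-∷-new {j} {suc r} c≡j = mk⇔ to′ from′
      where
      to′ : OpeningFrom j (suc r) (c ∷ w) → OpeningFrom (suc j) r w
      to′ (≥j , distinct) = >j , distinct′
        where
        >j : ∀ i → toℕ i < r → suc j ≤ toℕ (lookup w i)
        >j i i<r = ≤∧≢⇒< (≥j (suc i) (s<s i<r))
                         (λ j≡wi → distinct zero (suc i) z<s (s<s i<r) (λ ()) (toℕ-injective (trans c≡j j≡wi)))
        distinct′ : FirstDistinct r w
        distinct′ i i′ i<r i′<r i≢i′ = distinct (suc i) (suc i′) (s<s i<r) (s<s i′<r) (i≢i′ ∘ Fin.suc-injective)
      from′ : OpeningFrom (suc j) r w → OpeningFrom j (suc r) (c ∷ w)
      from′ (>j , distinct) = ≥j , distinct′
        where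
        ≥j : ∀ i → toℕ i < suc r → j ≤ toℕ (lookup (c ∷ w) i)
        ≥j zero    _          = ≤-reflexive (sym c≡j)
        ≥j (suc i) (s≤s i<r) = <⇒≤ (>j i i<r)
        distinct′ : FirstDistinct (suc r) (c ∷ w)
        distinct′ zero    zero     _          _           0≢0 _ = 0≢0 refl
        distinct′ zero    (suc i′) _          (s≤s i′<r) _   c≡wi′ = <-irrefl (trans (sym c≡j) (cong toℕ c≡wi′)) (>j i′ i′<r)
        distinct′ (suc i) zero     (s≤s i<r) _           _   wi≡c = <-irrefl (trans (sym c≡j) (cong toℕ (sym wi≡c))) (>j i i<r)
        distinct′ (suc i) (suc i′) (s≤s i<r) (s≤s i′<r) i≢i′ = distinct i i′ i<r i′<r (i≢i′ ∘ cong suc)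

    meets-∷ : ∀ ds ds′ → demand ds′ (toℕ c) ≡ demand ds (toℕ c) ∸ 1 →
              (∀ d → c ≢ d → demand ds′ (toℕ d) ≡ demand ds (toℕ d)) →
              MeetsDemands ds (c ∷ w) ⇔ MeetsDemands ds′ w
    meets-∷ ds ds′ at-c elsewhere = mk⇔ to′ from′
      where
      to′ : MeetsDemands ds (c ∷ w) → MeetsDemands ds′ w
      to′ meets d with toℕ c ≟ℕ toℕ d
      ... | no c≢d = subst₂ _≤_ (sym (elsewhere d (c≢d ∘ cong toℕ))) (blockSize-∷-≢ c w (c≢d ∘ cong toℕ)) (meets d)
      ... | yes c≡d with toℕ-injective c≡d
      ...   | refl = subst (_≤ blockSize w c) (sym at-c) (m≤n+o⇒m∸n≤o _ 1 (subst (_ ≤_) (blockSize-∷-≡ c w) (meets c)))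
      from′ : MeetsDemands ds′ w → MeetsDemands ds (c ∷ w)
      from′ meets d with toℕ c ≟ℕ toℕ d
      ... | no c≢d = subst₂ _≤_ (elsewhere d (c≢d ∘ cong toℕ)) (sym (blockSize-∷-≢ c w (c≢d ∘ cong toℕ))) (meets d)
      ... | yes c≡d with toℕ-injective c≡d
      ...   | refl = subst (_ ≤_) (sym (blockSize-∷-≡ c w))
                       (≤-trans (m≤n+m∸n (demand ds (toℕ c)) 1) (s≤s (subst (_≤ blockSize w c) at-c (meets c))))

    valid-∷-old : ∀ ds → toℕ c < length ds → Valid ds 0 (c ∷ w) ⇔ Valid (decAt (toℕ c) ds) 0 w
    valid-∷-old ds c<j =
      subst (λ j → Valid ds 0 (c ∷ w) ⇔ ValidAt j (decAt (toℕ c) ds) 0 w) (sym (length-decAt (toℕ c) ds))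
        (mk⇔ (λ (cov , can , _ , meets) →
                covered-∷-old c<j cov , canonical-tail c<j ≤-refl can , opening-zero w , to demands meets)
             (λ (cov , can , _ , meets) →
                covered-∷ cov , canonical-∷ (<⇒≤ c<j) (λ _ → inj₁) can , opening-zero (c ∷ w) , from demands meets))
      where
      demands : MeetsDemands ds (c ∷ w) ⇔ MeetsDemands (decAt (toℕ c) ds) w
      demands = meets-∷ ds (decAt (toℕ c) ds) (demand-decAt-≡ ds c<j) (λ _ c≢d → demand-decAt-≢ ds (c≢d ∘ toℕ-injective))

    ¬valid-∷-old : ∀ ds {r} → toℕ c < length ds → ¬ Valid ds (suc r) (c ∷ w)
    ¬valid-∷-old ds c<j (_ , _ , opening , _) = ¬opening-∷-old c<j opening

    valid-∷-new : ∀ ds r → toℕ c ≡ length ds → Valid ds r (c ∷ w) ⇔ Valid (ds ∷ʳ (s ∸ 1)) (r ∸ 1) w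
    valid-∷-new ds r c≡j =
      subst (λ j → Valid ds r (c ∷ w) ⇔ ValidAt j (ds ∷ʳ (s ∸ 1)) (r ∸ 1) w) (sym (length-∷ʳ ds (s ∸ 1)))
        (mk⇔ (λ (cov , can , opening , meets) →
                to (covered-∷-new c≡j) cov , canonical-tail (s≤s (≤-reflexive c≡j)) (n≤1+n _) can ,
                to (opening-∷-new c≡j) opening , to demands meets)
             (λ (cov , can , opening , meets) →
                from (covered-∷-new c≡j) cov , canonical-∷ (≤-reflexive c≡j) new⇒c can ,
                from (opening-∷-new c≡j) opening , from demands meets))
      where
      demands : MeetsDemands ds (c ∷ w) ⇔ MeetsDemands (ds ∷ʳ (s ∸ 1)) w
      demands = meets-∷ ds (ds ∷ʳ (s ∸ 1))
                  (subst (λ i → demand (ds ∷ʳ (s ∸ 1)) i ≡ demand ds i ∸ 1) (sym c≡j) (demand-∷ʳ-≡ ds))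
                  (λ d c≢d → demand-∷ʳ-≢ ds (s ∸ 1) (λ d≡j → c≢d (toℕ-injective (trans c≡j (sym d≡j)))))
      new⇒c : ∀ d → toℕ d < suc (length ds) → toℕ d < length ds ⊎ d ≡ c
      new⇒c d d<1+j = Sum.map₂ (λ d≡j → toℕ-injective (trans d≡j (sym c≡j))) (m<1+n⇒m<n∨m≡n d<1+j)

    ¬valid-∷-skip : ∀ ds {r} → length ds < toℕ c → ¬ Valid ds r (c ∷ w)
    ¬valid-∷-skip ds j<c (_ , can , _ , _) = <⇒≱ j<c (canonical-head can)

  ¬valid-[] : ∀ ds {r} → length ds < K → ¬ Valid ds r []
  ¬valid-[] ds j<K (cov , _) with cov (fromℕ< j<K)
  ... | inj₁ j<j      = <-irrefl (toℕ-fromℕ< j<K) j<j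
  ... | inj₂ (() , _)

  valid-[] : ∀ ds {r} → length ds ≡ K → Valid ds r [] ⇔ All (_≡ 0) ds
  valid-[] ds {r} j≡K = mk⇔ to′ from′
    where
    below-j : (c : Fin K) → toℕ c < length ds
    below-j c = subst (toℕ c <_) (sym j≡K) (toℕ<n c)
    to′ : Valid ds r [] → All (_≡ 0) ds
    to′ (_ , _ , _ , meets) = demand⇒All-zero ds λ i i<j →
      let i<K = subst (i <_) j≡K i<j in n≤0⇒n≡0 (subst (λ i → demand ds i ≤ 0) (toℕ-fromℕ< i<K) (meets (fromℕ< i<K)))
    from′ : All (_≡ 0) ds → Valid ds r []
    from′ zeros = (λ c → inj₁ (below-j c)) , (λ ()) , ((λ ()) , (λ ())) ,
                  (λ c → ≤-reflexive (All-zero⇒demand zeros (below-j c)))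

  count-[] : ∀ ds r → length ds ≡ K → count (valid? {0} ds r) ≡ allZero ds
  count-[] ds r j≡K with valid? ds r []
  ... | yes valid = trans (cong length (filter-accept (valid? ds r) valid)) (sym (allZero-yes (to (valid-[] ds j≡K) valid)))
  ... | no ¬valid = trans (cong length (filter-reject (valid? ds r) ¬valid)) (sym (allZero-no (¬valid ∘ from (valid-[] ds j≡K))))

  countAfter : ℕ → List ℕ → ℕ → ℕ → ℕ
  countAfter n ds zero    i with <-cmp i (length ds)
  ... | tri< _ _ _ = count (valid? {n} (decAt i ds) 0)
  ... | tri≈ _ _ _ = count (valid? {n} (ds ∷ʳ (s ∸ 1)) 0)
  ... | tri> _ _ _ = 0
  countAfter n ds (suc r) i with <-cmp i (length ds)
  ... | tri< _ _ _ = 0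
  ... | tri≈ _ _ _ = count (valid? {n} (ds ∷ʳ (s ∸ 1)) r)
  ... | tri> _ _ _ = 0

  count-∷ : ∀ n ds r (c : Fin K) → count (λ w → valid? {suc n} ds r (c ∷ w)) ≡ countAfter n ds r (toℕ c)
  count-∷ n ds zero c with <-cmp (toℕ c) (length ds)
  ... | tri< c<j _ _ = length-filter-cong _ _ (λ _ → valid-∷-old ds c<j) (allLabelings n K)
  ... | tri≈ _ c≡j _ = length-filter-cong _ _ (λ _ → valid-∷-new ds 0 c≡j) (allLabelings n K)
  ... | tri> _ _ j<c = length-filter-none _ (λ _ → ¬valid-∷-skip ds j<c) (allLabelings n K)
  count-∷ n ds (suc r) c with <-cmp (toℕ c) (length ds)
  ... | tri< c<j _ _ = length-filter-none _ (λ _ → ¬valid-∷-old ds c<j) (allLabelings n K)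
  ... | tri≈ _ c≡j _ = length-filter-cong _ _ (λ _ → valid-∷-new ds (suc r) c≡j) (allLabelings n K)
  ... | tri> _ _ j<c = length-filter-none _ (λ _ → ¬valid-∷-skip ds j<c) (allLabelings n K)

  count-valid-suc : ∀ n ds r → count (valid? {suc n} ds r) ≡ ∑< K (countAfter n ds r)
  count-valid-suc n ds r =
    trans (count-suc (valid? ds r)) (trans (cong sum (map-cong (count-∷ n ds r) (allFin K))) (sum-allFin K (countAfter n ds r)))

  countAfter-old : ∀ {n ds i} → i < length ds → countAfter n ds 0 i ≡ count (valid? {n} (decAt i ds) 0)
  countAfter-old {n} {ds} {i} i<j with <-cmp i (length ds)
  ... | tri< _ _ _    = refl
  ... | tri≈ i≮j _ _ = contradiction i<j i≮j
  ... | tri> i≮j _ _ = contradiction i<j i≮j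

  countAfter-new : ∀ {n ds} r {i} → i ≡ length ds → countAfter n ds r i ≡ count (valid? {n} (ds ∷ʳ (s ∸ 1)) (r ∸ 1))
  countAfter-new {n} {ds} zero {i} i≡j with <-cmp i (length ds)
  ... | tri< _ i≢j _ = contradiction i≡j i≢j
  ... | tri≈ _ _ _    = refl
  ... | tri> _ i≢j _ = contradiction i≡j i≢j
  countAfter-new {n} {ds} (suc r) {i} i≡j with <-cmp i (length ds)
  ... | tri< _ i≢j _ = contradiction i≡j i≢j
  ... | tri≈ _ _ _    = refl
  ... | tri> _ i≢j _ = contradiction i≡j i≢j

  countAfter-skip : ∀ {n ds} r {i} → length ds < i → countAfter n ds r i ≡ 0
  countAfter-skip {n} {ds} zero {i} j<i with <-cmp i (length ds)
  ... | tri< _ _ j≮i = contradiction j<i j≮i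
  ... | tri≈ _ _ j≮i = contradiction j<i j≮i
  ... | tri> _ _ _    = refl
  countAfter-skip {n} {ds} (suc r) {i} j<i with <-cmp i (length ds)
  ... | tri< _ _ j≮i = contradiction j<i j≮i
  ... | tri≈ _ _ j≮i = contradiction j<i j≮i
  ... | tri> _ _ _    = refl

  countAfter-opening-≢ : ∀ {n ds r i} → i ≢ length ds → countAfter n ds (suc r) i ≡ 0
  countAfter-opening-≢ {n} {ds} {r} {i} i≢j with <-cmp i (length ds)
  ... | tri< _ _ _   = refl
  ... | tri≈ _ i≡j _ = contradiction i≡j i≢j
  ... | tri> _ _ _   = refl

  ∑-countAfter-unopened : ∀ n ds m → ∑[ i < suc m ] countAfter n ds 0 (length ds + i) ≡ count (valid? {n} (ds ∷ʳ (s ∸ 1)) 0)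
  ∑-countAfter-unopened n ds m = begin
    ∑[ i < suc m ] countAfter n ds 0 (length ds + i)
      ≡⟨ ∑-single {suc m} 0 (λ i → countAfter n ds 0 (length ds + i)) z<s
                    (λ i _ i≢0 → countAfter-skip {n} {ds} 0 (m<m+n (length ds) (n≢0⇒n>0 i≢0))) ⟩
    countAfter n ds 0 (length ds + 0)
      ≡⟨ countAfter-new {n} {ds} 0 (+-identityʳ (length ds)) ⟩
    count (valid? {n} (ds ∷ʳ (s ∸ 1)) 0)
      ∎

  -- The r forced elements open the blocks length ds, …, length ds + r − 1 in this order.
  count-opening : ∀ r ds n → length ds + r ≤ K →
    count (valid? {n + r} ds r) ≡ count (valid? {n} (ds ++ replicate r (s ∸ 1)) 0)
  count-opening zero ds n _ = cong₂ (λ m ds → count (valid? {m} ds 0)) (+-identityʳ n) (sym (++-identityʳ ds))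
  count-opening (suc r) ds n j+r<K = begin
    count (valid? {n + suc r} ds (suc r))
      ≡⟨ cong (λ m → count (valid? {m} ds (suc r))) (+-suc n r) ⟩
    count (valid? {suc (n + r)} ds (suc r))
      ≡⟨ count-valid-suc (n + r) ds (suc r) ⟩
    ∑< K (countAfter (n + r) ds (suc r))
      ≡⟨ ∑-single (length ds) _ (<-≤-trans (m<m+n (length ds) z<s) j+r<K) (λ _ _ → countAfter-opening-≢) ⟩
    countAfter (n + r) ds (suc r) (length ds)
      ≡⟨ countAfter-new {n + r} {ds} (suc r) refl ⟩
    count (valid? {n + r} (ds ∷ʳ (s ∸ 1)) r)
      ≡⟨ count-opening r (ds ∷ʳ (s ∸ 1)) n (≤-trans (≤-reflexive j+1+r≡) j+r<K) ⟩
    count (valid? {n} ((ds ∷ʳ (s ∸ 1)) ++ replicate r (s ∸ 1)) 0)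
      ≡⟨ cong (λ ds → count (valid? {n} ds 0)) (++-assoc ds [ s ∸ 1 ] (replicate r (s ∸ 1))) ⟩
    count (valid? {n} (ds ++ replicate (suc r) (s ∸ 1)) 0)
      ∎
    where
    j+1+r≡ : length (ds ∷ʳ (s ∸ 1)) + r ≡ length ds + suc r
    j+1+r≡ = trans (cong (_+ r) (length-∷ʳ ds (s ∸ 1))) (sym (+-suc (length ds) r))

  -- The k unopened blocks can be opened in any of k! orders.
  count≡wordsAtLeast : 1 ≤ s → ∀ ds k n → length ds + k ≡ K →
    k ! * count (valid? {n} ds 0) ≡ wordsAtLeast (ds ++ replicate k s) n
  count≡wordsAtLeast 1≤s ds zero zero j+0≡K = begin
    1 * count (valid? {0} ds 0)  ≡⟨ *-identityˡ _ ⟩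
    count (valid? {0} ds 0)      ≡⟨ count-[] ds 0 (trans (sym (+-identityʳ _)) j+0≡K) ⟩
    allZero ds                   ≡⟨ cong allZero (++-identityʳ ds) ⟨
    allZero (ds ++ [])           ∎
  count≡wordsAtLeast 1≤s ds (suc k) zero j+k≡K = begin
    suc k ! * count (valid? {0} ds 0)
      ≡⟨ cong (suc k ! *_) (length-filter-none (valid? ds 0) (λ { [] → ¬valid-[] ds j<K }) (allLabelings 0 K)) ⟩
    suc k ! * 0
      ≡⟨ *-zeroʳ (suc k !) ⟩
    0
      ≡⟨ allZero-no (λ zeros → <⇒≢ 1≤s (sym (All.head (++⁻ʳ ds zeros)))) ⟨
    allZero (ds ++ replicate (suc k) s)
      ∎
    where
    j<K : length ds < K
    j<K = subst (length ds <_) j+k≡K (m<m+n (length ds) z<s)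
  count≡wordsAtLeast 1≤s ds k (suc n) j+k≡K = begin
    k ! * count (valid? {suc n} ds 0)
      ≡⟨ cong (k ! *_) (count-valid-suc n ds 0) ⟩
    k ! * ∑< K (countAfter n ds 0)
      ≡⟨ cong (λ m → k ! * ∑< m (countAfter n ds 0)) (sym j+k≡K) ⟩
    k ! * ∑< (j + k) (countAfter n ds 0)
      ≡⟨ cong (k ! *_) (∑-split j k (countAfter n ds 0)) ⟩
    k ! * (∑< j (countAfter n ds 0) + ∑[ i < k ] countAfter n ds 0 (j + i))
      ≡⟨ *-distribˡ-+ (k !) _ _ ⟩
    k ! * ∑< j (countAfter n ds 0) + k ! * ∑[ i < k ] countAfter n ds 0 (j + i)
      ≡⟨ cong₂ _+_ old-blocks (new-block k j+k≡K) ⟩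
    ∑[ i < j ] W (decAt i ds ++ replicate k s) + ∑[ i < k ] W (ds ++ decAt i (replicate k s))
      ≡⟨ cong (λ m → ∑[ i < j ] W (decAt i ds ++ replicate k s) + ∑[ i < m ] W (ds ++ decAt i (replicate k s)))
              (length-replicate k) ⟨
    ∑[ i < j ] W (decAt i ds ++ replicate k s) + ∑[ i < length (replicate k s) ] W (ds ++ decAt i (replicate k s))
      ≡⟨ wordsAtLeast-++-suc ds (replicate k s) n ⟨
    wordsAtLeast (ds ++ replicate k s) (suc n)
      ∎
    where
    j : ℕ
    j = length ds
    W : List ℕ → ℕ
    W xs = wordsAtLeast xs n
    old-blocks : k ! * ∑< j (countAfter n ds 0) ≡ ∑[ i < j ] W (decAt i ds ++ replicate k s)
    old-blocks = trans (*-distribˡ-∑ j (k !) _) (∑-cong j λ i i<j → trans (cong (k ! *_) (countAfter-old i<j))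
                   (count≡wordsAtLeast 1≤s (decAt i ds) k n (trans (cong (_+ k) (length-decAt i ds)) j+k≡K)))
    new-block : ∀ k → j + k ≡ K → k ! * ∑[ i < k ] countAfter n ds 0 (j + i) ≡ ∑[ i < k ] W (ds ++ decAt i (replicate k s))
    new-block zero    _      = refl
    new-block (suc m) j+m≡K = begin
      suc m ! * ∑[ i < suc m ] countAfter n ds 0 (j + i)
        ≡⟨ cong (suc m ! *_) (∑-countAfter-unopened n ds m) ⟩
      suc m ! * count (valid? {n} (ds ∷ʳ (s ∸ 1)) 0)
        ≡⟨ *-assoc (suc m) (m !) _ ⟩
      suc m * (m ! * count (valid? {n} (ds ∷ʳ (s ∸ 1)) 0))
        ≡⟨ cong (suc m *_) (count≡wordsAtLeast 1≤s (ds ∷ʳ (s ∸ 1)) m n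
                              (trans (cong (_+ m) (length-∷ʳ ds (s ∸ 1))) (trans (sym (+-suc j m)) j+m≡K))) ⟩
      suc m * W ((ds ∷ʳ (s ∸ 1)) ++ replicate m s)
        ≡⟨ cong (λ xs → suc m * W xs) (++-assoc ds [ s ∸ 1 ] (replicate m s)) ⟩
      suc m * W (ds ++ (s ∸ 1) ∷ replicate m s)
        ≡⟨ wordsAtLeast-decAt-replicate ds m s n ⟨
      ∑[ i < suc m ] W (ds ++ decAt i (replicate (suc m) s))
        ∎

  IsPartition⇔Valid : ∀ {n} r (v : Vec (Fin K) n) → IsPartition s r v ⇔ Valid [] r v
  IsPartition⇔Valid r v = mk⇔
    (λ (surj , canon , distinct , blocks) →
       inj₂ ∘ surj , (λ i c c<vi → inj₂ (canon i c c<vi)) , ((λ _ _ → z≤n) , distinct) , blocks)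
    (λ (cov , can , (_ , distinct) , blocks) →
       [ (λ ()) , id ]′ ∘ cov , (λ i c c<vi → [ (λ ()) , id ]′ (can i c c<vi)) , distinct , blocks)

  S≡count : ∀ r n → S s r n K ≡ count (valid? {n} [] r)
  S≡count r n = length-filter-cong (isPartition? s r) (valid? [] r) (IsPartition⇔Valid r) (allLabelings n K)

k!S≡wordsAtLeast : ∀ {s} → 1 ≤ s → ∀ r k n →
  k ! * S s r (n + r) (k + r) ≡ wordsAtLeast (blockDemands s r k) n
k!S≡wordsAtLeast {s} 1≤s r k n = begin
  k ! * S s r (n + r) (k + r)
    ≡⟨ cong (k ! *_) (S≡count r (n + r)) ⟩
  k ! * count (valid? {n + r} [] r)
    ≡⟨ cong (k ! *_) (count-opening r [] n (m≤n+m r k)) ⟩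
  k ! * count (valid? {n} (replicate r (s ∸ 1)) 0)
    ≡⟨ count≡wordsAtLeast 1≤s (replicate r (s ∸ 1)) k n (trans (cong (_+ k) (length-replicate r)) (+-comm r k)) ⟩
  wordsAtLeast (blockDemands s r k) n
    ∎
  where open LabelCounting s (k + r)

-- Multinomial convolution

composition-sum-suc : ∀ p m (f : Vec ℕ (suc p) → ℕ) →
  sum (map f (compositions (suc p) m)) ≡ ∑[ l < suc m ] sum (map (f ∘ (l ∷_)) (compositions p (m ∸ l)))
composition-sum-suc p m f = begin
  sum (map f (concatMap (λ l → map (l ∷_) (compositions p (m ∸ l))) (upTo (suc m))))
    ≡⟨ sum-concatMap f (λ l → map (l ∷_) (compositions p (m ∸ l))) (upTo (suc m)) ⟩
  sum (map (λ l → sum (map f (map (l ∷_) (compositions p (m ∸ l))))) (upTo (suc m)))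
    ≡⟨ sum-applyUpTo (suc m) id (λ l → sum (map f (map (l ∷_) (compositions p (m ∸ l))))) ⟩
  ∑[ l < suc m ] sum (map f (map (l ∷_) (compositions p (m ∸ l))))
    ≡⟨ ∑-cong (suc m) (λ l _ → cong sum (map-∘ {g = f} {f = l ∷_} (compositions p (m ∸ l)))) ⟨
  ∑[ l < suc m ] sum (map (f ∘ (l ∷_)) (compositions p (m ∸ l)))
    ∎

composition-sum-cong : ∀ p m (f g : Vec ℕ p → ℕ) → (∀ ls → vsum ls ≡ m → f ls ≡ g ls) →
  sum (map f (compositions p m)) ≡ sum (map g (compositions p m))
composition-sum-cong zero    zero    f g f≡g = cong (_+ 0) (f≡g [] refl)
composition-sum-cong zero    (suc m) f g f≡g = refl
composition-sum-cong (suc p) m       f g f≡g = begin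
  sum (map f (compositions (suc p) m))
    ≡⟨ composition-sum-suc p m f ⟩
  ∑[ l < suc m ] sum (map (f ∘ (l ∷_)) (compositions p (m ∸ l)))
    ≡⟨ ∑-cong (suc m) (λ l l<1+m → composition-sum-cong p (m ∸ l) _ _ (λ ls ls≡ →
         f≡g (l ∷ ls) (trans (cong (l +_) ls≡) (m+[n∸m]≡n (s≤s⁻¹ l<1+m))))) ⟩
  ∑[ l < suc m ] sum (map (g ∘ (l ∷_)) (compositions p (m ∸ l)))
    ≡⟨ composition-sum-suc p m g ⟨
  sum (map g (compositions (suc p) m))
    ∎

multinomial-⊛ : ∀ p (f : Fin p → ℕ → ℕ) m →
  sum (map (λ ls → multinomial ls * prodFin p (λ i → f i (lookup ls i))) (compositions p m)) ≡ ⊛ⁿ p f m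
multinomial-⊛ zero    f zero    = refl
multinomial-⊛ zero    f (suc m) = refl
multinomial-⊛ (suc p) f m       = begin
  sum (map (summand (suc p) f) (compositions (suc p) m))
    ≡⟨ composition-sum-suc p m (summand (suc p) f) ⟩
  ∑[ l < suc m ] sum (map (summand (suc p) f ∘ (l ∷_)) (compositions p (m ∸ l)))
    ≡⟨ ∑-cong (suc m) (λ l l<1+m → with-first-part l (s≤s⁻¹ l<1+m)) ⟩
  (f zero ⊛ ⊛ⁿ p (f ∘ suc)) m
    ∎
  where
  summand : ∀ p → (Fin p → ℕ → ℕ) → Vec ℕ p → ℕ
  summand p f ls = multinomial ls * prodFin p (λ i → f i (lookup ls i))
  reassoc : ∀ c μ a π → (c * μ) * (a * π) ≡ c * (a * (μ * π))
  reassoc = solve-∀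
  with-first-part : ∀ l → l ≤ m → sum (map (summand (suc p) f ∘ (l ∷_)) (compositions p (m ∸ l))) ≡
                              (m C l) * (f zero l * ⊛ⁿ p (f ∘ suc) (m ∸ l))
  with-first-part l l≤m = begin
    sum (map (summand (suc p) f ∘ (l ∷_)) (compositions p (m ∸ l)))
      ≡⟨ composition-sum-cong p (m ∸ l) _ _ (λ ls ls≡ →
           trans (cong₂ (λ n π → ((n C l) * multinomial ls) * π) (trans (cong (l +_) ls≡) (m+[n∸m]≡n l≤m))
                        (prodFin-suc p (λ i → f i (lookup (l ∷ ls) i))))
                 (reassoc (m C l) (multinomial ls) (f zero l) _)) ⟩
    sum (map (λ ls → (m C l) * (f zero l * summand p (f ∘ suc) ls)) (compositions p (m ∸ l)))
      ≡⟨ *-distribˡ-sum (m C l) (λ ls → f zero l * summand p (f ∘ suc) ls) (compositions p (m ∸ l)) ⟨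
    (m C l) * sum (map (λ ls → f zero l * summand p (f ∘ suc) ls) (compositions p (m ∸ l)))
      ≡⟨ cong ((m C l) *_) (*-distribˡ-sum (f zero l) (summand p (f ∘ suc)) (compositions p (m ∸ l))) ⟨
    (m C l) * (f zero l * sum (map (summand p (f ∘ suc)) (compositions p (m ∸ l))))
      ≡⟨ cong (λ x → (m C l) * (f zero l * x)) (multinomial-⊛ p (f ∘ suc) (m ∸ l)) ⟩
    (m C l) * (f zero l * ⊛ⁿ p (f ∘ suc) (m ∸ l))
      ∎

[m+n]Cm*m!*n!≡[m+n]! : ∀ a b → ((a + b) C a) * (a ! * b !) ≡ (a + b) !
[m+n]Cm*m!*n!≡[m+n]! a b = subst (λ c → ((a + b) C a) * (a ! * c !) ≡ (a + b) !) (m+n∸m≡n a b)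
  (trans (cong (_* (a ! * (a + b ∸ a) !)) (nCk≡n!/k![n-k]! a≤a+b))
         (m/n*n≡m {{a !* (a + b ∸ a) !≢0}} (k![n∸k]!∣n! a≤a+b)))
  where
  a≤a+b : a ≤ a + b
  a≤a+b = m≤m+n a b

factorials : ∀ {p} → Vec ℕ p → ℕ
factorials {p} ks = prodFin p (λ i → lookup ks i !)

multinomial*factorials : ∀ {p} (ks : Vec ℕ p) → multinomial ks * factorials ks ≡ vsum ks !
multinomial*factorials []       = refl
multinomial*factorials {suc p} (k ∷ ks) = begin
  (((k + vsum ks) C k) * multinomial ks) * factorials (k ∷ ks)
    ≡⟨ cong ((((k + vsum ks) C k) * multinomial ks) *_) (prodFin-suc p (λ i → lookup (k ∷ ks) i !)) ⟩
  (((k + vsum ks) C k) * multinomial ks) * (k ! * factorials ks)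
    ≡⟨ reassoc ((k + vsum ks) C k) (multinomial ks) (k !) (factorials ks) ⟩
  ((k + vsum ks) C k) * (k ! * (multinomial ks * factorials ks))
    ≡⟨ cong (λ x → ((k + vsum ks) C k) * (k ! * x)) (multinomial*factorials ks) ⟩
  ((k + vsum ks) C k) * (k ! * vsum ks !)
    ≡⟨ [m+n]Cm*m!*n!≡[m+n]! k (vsum ks) ⟩
  (k + vsum ks) !
    ∎
  where
  reassoc : ∀ c μ a π → (c * μ) * (a * π) ≡ c * (a * (μ * π))
  reassoc = solve-∀

factorials≢0 : ∀ {p} (ks : Vec ℕ p) → NonZero (factorials ks)
factorials≢0 {p} ks = product≢0 (map⁺ (universal (λ i → lookup ks i !≢0) (allFin p)))

S-vanishes : ∀ {s} → 1 ≤ s → ∀ r k l → l < s * k + (s ∸ 1) * r → S s r (l + r) (k + r) ≡ 0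
S-vanishes {s} 1≤s r k l l<min = *-cancelˡ-≡ _ 0 (k !) {{k !≢0}} (begin
  k ! * S s r (l + r) (k + r)        ≡⟨ k!S≡wordsAtLeast 1≤s r k l ⟩
  wordsAtLeast (blockDemands s r k) l ≡⟨ wordsAtLeast-< (blockDemands s r k) l (subst (l <_) min≡sum l<min) ⟩
  0                                  ≡⟨ *-zeroʳ (k !) ⟨
  k ! * 0                            ∎)
  where
  min≡sum : s * k + (s ∸ 1) * r ≡ sum (blockDemands s r k)
  min≡sum = begin
    s * k + (s ∸ 1) * r                                  ≡⟨ +-comm (s * k) _ ⟩
    (s ∸ 1) * r + s * k                                  ≡⟨ cong₂ _+_ (*-comm (s ∸ 1) r) (*-comm s k) ⟩
    r * (s ∸ 1) + k * s                                  ≡⟨ cong₂ _+_ (sum-replicate r (s ∸ 1)) (sum-replicate k s) ⟨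
    sum (replicate r (s ∸ 1)) + sum (replicate k s)      ≡⟨ sum-++ (replicate r (s ∸ 1)) (replicate k s) ⟨
    sum (blockDemands s r k)                             ∎

module _ (s : ℕ) {p} (ks rs : Vec ℕ p) where

  piece : Fin p → ℕ → ℕ
  piece i l = S s (lookup rs i) (l + lookup rs i) (lookup ks i + lookup rs i)

  term : Vec ℕ p → ℕ
  term ls = multinomial ls * prodFin p (λ i → piece i (lookup ls i))

  module _ (1≤s : 1 ≤ s) where

    term-vanishes : ∀ ls → ¬ Admissible s ks rs ls → term ls ≡ 0
    term-vanishes ls inadmissible with ¬∀⟶∃¬ p _ (λ i → s * lookup ks i + (s ∸ 1) * lookup rs i ≤? lookup ls i) inadmissible
    ... | i , ls-small = trans (cong (multinomial ls *_) (prodFin-zero _ i (S-vanishes 1≤s _ _ _ (≰⇒> ls-small))))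
                               (*-zeroʳ (multinomial ls))

    factorials*identity : ∀ n →
      factorials ks * (multinomial ks * S s (vsum rs) (n + vsum rs) (vsum ks + vsum rs)) ≡
      factorials ks * sum (map term (compositions p n))
    factorials*identity n = begin
      factorials ks * (multinomial ks * S s R (n + R) (K + R))
        ≡⟨ *-assoc-comm (factorials ks) (multinomial ks) _ ⟩
      (multinomial ks * factorials ks) * S s R (n + R) (K + R)
        ≡⟨ cong (_* S s R (n + R) (K + R)) (multinomial*factorials ks) ⟩
      K ! * S s R (n + R) (K + R)
        ≡⟨ k!S≡wordsAtLeast 1≤s R K n ⟩
      wordsAtLeast (blockDemands s R K) n
        ≡⟨ wordsAtLeast-↭ (concat-blockDemands-↭ s ks rs) n ⟨
      wordsAtLeast (concat (map D (allFin p))) n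
        ≡⟨ wordsAtLeast-concat p D n ⟩
      ⊛ⁿ p (wordsAtLeast ∘ D) n
        ≡⟨ ⊛ⁿ-cong p (λ i l → sym (k!S≡wordsAtLeast 1≤s (lookup rs i) (lookup ks i) l)) n ⟩
      ⊛ⁿ p (λ i l → lookup ks i ! * piece i l) n
        ≡⟨ multinomial-⊛ p (λ i l → lookup ks i ! * piece i l) n ⟨
      sum (map (λ ls → multinomial ls * prodFin p (λ i → lookup ks i ! * piece i (lookup ls i))) (compositions p n))
        ≡⟨ cong sum (map-cong pull-factorials (compositions p n)) ⟩
      sum (map (λ ls → factorials ks * term ls) (compositions p n))
        ≡⟨ *-distribˡ-sum (factorials ks) term (compositions p n) ⟨
      factorials ks * sum (map term (compositions p n))
        ∎
      where
      R K : ℕ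
      R = vsum rs
      K = vsum ks
      D : Fin p → List ℕ
      D i = blockDemands s (lookup rs i) (lookup ks i)
      *-assoc-comm : ∀ x y z → x * (y * z) ≡ (y * x) * z
      *-assoc-comm = solve-∀
      *-left-comm : ∀ x y z → x * (y * z) ≡ y * (x * z)
      *-left-comm = solve-∀
      pull-factorials : ∀ ls → multinomial ls * prodFin p (λ i → lookup ks i ! * piece i (lookup ls i)) ≡ factorials ks * term ls
      pull-factorials ls = trans (cong (multinomial ls *_) (sym (prodFin-* p _ _))) (*-left-comm (multinomial ls) (factorials ks) _)

mainTheorem16 : (p : ℕ) → 1 ≤ p → (ks rs : Vec ℕ p) → (s : ℕ) → 1 ≤ s →
    (n : ℕ) → s * vsum ks ≤ n →
    multinomial ks * S s (vsum rs) (n + vsum rs) (vsum ks + vsum rs)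
      ≡ lsum (map (λ ls → multinomial ls *
                     prodFin p (λ i → S s (lookup rs i) (lookup ls i + lookup rs i)
                                        (lookup ks i + lookup rs i)))
                  (filter (admissible? s ks rs) (compositions p n)))
mainTheorem16 p _ ks rs s 1≤s n _ = begin
  multinomial ks * S s (vsum rs) (n + vsum rs) (vsum ks + vsum rs)
    ≡⟨ *-cancelˡ-≡ _ _ (factorials ks) {{factorials≢0 ks}} (factorials*identity s ks rs 1≤s n) ⟩
  sum (map (term s ks rs) (compositions p n))
    ≡⟨ sum-filter (admissible? s ks rs) (term s ks rs) (term-vanishes s ks rs 1≤s) (compositions p n) ⟨
  sum (map (term s ks rs) (filter (admissible? s ks rs) (compositions p n)))
    ∎
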